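{- Let $m\ge 1$ and let $\underline{r}=(r_1,\dots,r_m)$ be pairwise coprime integers $r_i\ge 2$. For $n\ge 0$ let $CP_{\underline{r},n}$ be the set of partitions of $n$ none of whose parts is divisible by any of $r_1,\dots,r_m$. For a partition $\rho$ write $\rho=(\rho_1,\dots,\rho_{\ell(\rho)})$ with $\ell(\rho)$ its number of parts and $m_i(\rho)$ the multiplicity of $i$ in $\rho$. Put $$a_{\underline{r},n}=\prod_{\rho\in CP_{\underline{r},n}}\prod_{i=1}^{\ell(\rho)}\rho_i,\qquad b_{\underline{r},n}=\prod_{\rho\in CP_{\underline{r},n}}\prod_{i\ge1} m_i(\rho)!,$$ and $W_{\underline{r},s,n}=\sum_{\rho\in CP_{\underline{r},n}}|\{i\ge1\mid m_i(\rho)\ge s\}|$ for $s\ge1$. For $1\le i\le m$ define $$c_{r_i,n}=\sum_{\substack{j\ge 1\\ r_l\nmid j \text{ for all } l}}\ \sum_{k_1,\dots,k_m\ge0} k_i\, W_{\underline{r},\,r_1^{k_1}\cdots r_m^{k_m}j,\,n}.$$ Then $$b_{\underline{r},n}=\prod_{i=1}^m r_i^{\,c_{r_i,n}}\; a_{\underline{r},n}.$$ -}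

module Defs where

open import Data.Nat using (ℕ; zero; suc; _+_; _*_; _^_; _≤_; _≥_; _!)
open import Data.Nat.Divisibility using (_∣_; _∣?_)
open import Data.Nat.ListAction using (sum; product)
open import Data.Fin using (Fin)
open import Data.Bool using (if_then_else_)
open import Data.List using (List; []; _∷_; map; length; filter; allFin)
open import Data.List.Relation.Unary.All using (All)
open import Data.List.Relation.Unary.Linked using (Linked)
open import Data.Product using (_×_)
open import Data.Vec.Functional using (Vector) renaming (_∷_ to _∷ᵥ_)
import Data.Nat.Properties as ℕₚ
open import Data.Fin.Properties using (all?)
open import Relation.Nullary using (¬_; does)
open import Relation.Nullary.Decidable using (¬?)
open import Relation.Unary using (Decidable)

-- [a .. b] as a list of naturals: a, a+1, ..., a+k-1  (k elements)
range : ℕ → ℕ → List ℕ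
range a zero    = []
range a (suc k) = a ∷ range (suc a) k

IsPartition : ℕ → List ℕ → Set
IsPartition n ρ = All (λ p → 1 ≤ p) ρ × Linked _≥_ ρ × sum ρ ≡ n
  where open import Relation.Binary.PropositionalEquality using (_≡_)

IsCP : {m : ℕ} → (Fin m → ℕ) → ℕ → List ℕ → Set
IsCP {m} r n ρ = IsPartition n ρ × All (λ p → (l : Fin m) → ¬ (r l ∣ p)) ρ

mult : ℕ → List ℕ → ℕ
mult i ρ = length (filter (ℕₚ._≟ i) ρ)

-- parts of a partition of n are among 1..n, so "i ≥ 1" ranges over 1..n
-- a_{r,n} = ∏_{ρ ∈ L} ∏ parts of ρ
aSeq : List (List ℕ) → ℕ
aSeq L = product (map product L)

bSeq : ℕ → List (List ℕ) → ℕ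
bSeq n L = product (map (λ ρ → product (map (λ i → mult i ρ !) (range 1 n))) L)

W : ℕ → List (List ℕ) → ℕ → ℕ
W n L s = sum (map (λ ρ → length (filter (λ i → s ℕₚ.≤? mult i ρ) (range 1 n))) L)

sumTuples : (m B : ℕ) → (Vector ℕ m → ℕ) → ℕ
sumTuples zero    B f = f (λ ())
sumTuples (suc m) B f = sum (map (λ k → sumTuples m B (λ v → f (k ∷ᵥ v))) (range 0 (suc B)))

prodFin : (m : ℕ) → (Fin m → ℕ) → ℕ
prodFin m f = product (map f (allFin m))

notDivAny? : {m : ℕ} (r : Fin m → ℕ) → Decidable (λ j → (l : Fin m) → ¬ (r l ∣ j))
notDivAny? r j = all? (λ l → ¬? (r l ∣? j))

-- c_{r_i,n} = Σ_{j ≥ 1, r_l ∤ j ∀ l} Σ_{k_1..k_m ≥ 0} k_i W_{r, r_1^{k_1}⋯r_m^{k_m} j, n}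
-- The summand vanishes unless r^k j ≤ n; since r_l ≥ 2 this forces j ≤ n and k_l ≤ n,
-- so the (finitely supported) sum is computed over j ∈ 1..n, k_l ∈ 0..n.
cSeq : {m : ℕ} → (Fin m → ℕ) → ℕ → List (List ℕ) → Fin m → ℕ
cSeq {m} r n L i =
  sum (map (λ j → sumTuples m n (λ k → k i * W n L (prodFin m (λ l → r l ^ k l) * j)))
           (filter (notDivAny? r) (range 1 n)))

module Submission where

-- Let R = [1..n], J ⊆ R the integers divisible by no rᵢ ("admissible"), K = [0..n]^m the
-- exponent tuples, rᵏ = ∏ᵢ rᵢ^{kᵢ}, W(s) = W_{r,s,n} and M(t) = Σ_ρ m_t(ρ).
--  (1) Writing mᵢ(ρ)! = ∏_{s ≤ mᵢ(ρ)} s and regrouping gives b = ∏_{s∈R} s^{W(s)}; regrouping the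
--      parts gives a = ∏_{j∈J} j^{M(j)}, since non-admissible integers are never parts.
--  (2) Every s ≥ 1 is uniquely rᵏ·j with j admissible (the rᵢ are coprime), so a product over
--      s ∈ R is a double product over j ∈ J, k ∈ K.
--  (3) Trading c copies of a part x for c′ copies of x′ when c·x = c′·x′ is a bijection, so
--      #{ρ : m_x(ρ) ≥ c} = #{ρ : m_{x′}(ρ) ≥ c′}; with (2) this yields M(j) = Σ_{k∈K} W(rᵏ·j).
-- Hence b = ∏_{j,k} (rᵏ·j)^{W(rᵏj)} = ∏_{j,k} (rᵏ)^{W(rᵏj)} · ∏_j j^{M(j)} = ∏ᵢ rᵢ^{c_{rᵢ,n}} · a.

open import Defs
open import Algebra.Core using (Op₂)
open import Algebra.Structures using (IsCommutativeMonoid)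
open import Data.Bool using (if_then_else_; true; false)
open import Data.Empty using (⊥-elim)
open import Data.Fin using (Fin; zero; suc)
import Data.Fin.Properties as Fin
open import Data.List using (List; []; _∷_; _++_; [_]; map; filter; foldr; length; replicate; allFin; cartesianProductWith; cartesianProduct)
open import Data.List.Membership.Propositional using (_∈_)
open import Data.List.Membership.Propositional.Properties using (∈-filter⁺; ∈-filter⁻; ∈-map⁺; ∈-map⁻; ∈-cartesianProductWith⁺; ∈-cartesianProduct⁺; ∈-cartesianProduct⁻)
open import Data.List.Membership.Propositional.Properties.WithK using (unique∧set⇒bag)
open import Data.List.Properties using (map-tabulate; length-map; filter-++; length-++; filter-reject; length-filter)
open import Data.List.Relation.Binary.BagAndSetEquality using (∼bag⇒↭)
open import Data.List.Relation.Binary.Permutation.Propositional using (_↭_; ↭⇒↭ₛ; ↭-refl; ↭-sym; ↭-trans; ↭-prep; ↭-swap; module PermutationReasoning)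
open import Data.List.Relation.Binary.Permutation.Propositional.Properties using (map⁺; All-resp-↭; filter-↭; ↭-length; ++⁺ˡ; drop-∷)
open import Data.List.Relation.Binary.Permutation.Setoid.Properties using (foldr-commMonoid)
open import Data.List.Relation.Binary.Pointwise using (Pointwise-≡⇒≡)
open import Data.List.Relation.Unary.All using (All; []; _∷_)
import Data.List.Relation.Unary.All as All
import Data.List.Relation.Unary.All.Properties as All
import Data.List.Relation.Unary.AllPairs as AllPairs
open import Data.List.Relation.Unary.Any using (here; there)
open import Data.List.Relation.Unary.Linked using (Linked)
open import Data.List.Relation.Unary.Sorted.TotalOrder.Properties using (↗↭↗⇒≋)
open import Data.List.Relation.Unary.Unique.Propositional using (Unique)
import Data.List.Relation.Unary.Unique.Propositional.Properties as Unique
import Data.List.Relation.Unary.Unique.Setoid as UniqueSetoid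
import Data.List.Relation.Unary.Unique.Setoid.Properties as UniqueSetoid
open import Data.Nat using (ℕ; zero; suc; >-nonZero; _+_; _*_; _^_; _≤_; _<_; _≥_; z≤n; s≤s; _!; _≤?_; _≟_)
open import Data.Nat.Coprimality using (Coprime; coprime-divisor)
open import Data.Nat.Divisibility using (_∣_; _∣?_; divides; ∣-trans; m∣m*n; n∣m*n)
open import Data.Nat.Induction using (<-wellFounded)
open import Data.Nat.ListAction using (sum; product)
open import Data.Nat.ListAction.Properties using (sum-↭; sum-++)
open import Data.Nat.Properties
open import Data.Product using (_×_; _,_; proj₁; proj₂; Σ-syntax)
open import Data.Product.Relation.Binary.Pointwise.NonDependent using (_×ₛ_)
open import Data.Vec.Functional using (Vector) renaming (_∷_ to _∷ᵥ_)
open import Function.Base using (_∘_)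
open import Function.Bundles using (_⇔_; mk⇔; module Equivalence)
open import Induction.WellFounded using (Acc; acc)
open import Level using (0ℓ)
open import Relation.Binary.Bundles using (Setoid)
open import Relation.Binary.Definitions using (DecidableEquality)
open import Relation.Binary.Properties.DecTotalOrder ≤-decTotalOrder using (≥-decTotalOrder)
open import Relation.Binary.Properties.TotalOrder ≤-totalOrder using (≥-totalOrder)
open import Relation.Binary.PropositionalEquality using (_≡_; _≢_; refl; sym; trans; cong; cong₂; subst; setoid; _→-setoid_; module ≡-Reasoning)
open import Relation.Nullary using (¬_; Dec; does; yes; no)
open import Relation.Unary using (Decidable)
open import Data.List.Sort.InsertionSort.Base ≥-decTotalOrder using (sort)
open import Data.List.Sort.InsertionSort.Properties ≥-decTotalOrder using (sort-↭; sort-↗)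

private variable
  A B : Set

unique-↭ : {xs ys : List A} → Unique xs → Unique ys →
           (∀ {z} → z ∈ xs → z ∈ ys) → (∀ {z} → z ∈ ys → z ∈ xs) → xs ↭ ys
unique-↭ xs! ys! xs⊆ys ys⊆xs = ∼bag⇒↭ (unique∧set⇒bag xs! ys! (mk⇔ xs⊆ys ys⊆xs))

map-unique : (S : Setoid 0ℓ 0ℓ) (f : Setoid.Carrier S → B) {xs : List (Setoid.Carrier S)} →
             (∀ {x y} → x ∈ xs → y ∈ xs → f x ≡ f y → Setoid._≈_ S x y) →
             UniqueSetoid.Unique S xs → Unique (map f xs)
map-unique S f {[]}     inj AllPairs.[]          = AllPairs.[]
map-unique S f {x ∷ xs} inj (x∉xs AllPairs.∷ xs!) =
  All.map⁺ (All.tabulate (λ y∈xs fx≡fy → All.lookup x∉xs y∈xs (inj (here refl) (there y∈xs) fx≡fy)))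
  AllPairs.∷ map-unique S f (λ x∈ y∈ → inj (there x∈) (there y∈)) xs!

module Big {C : Set} (_∙_ : Op₂ C) (ε : C) (isCM : IsCommutativeMonoid _≡_ _∙_ ε) where

  open IsCommutativeMonoid isCM using (assoc; comm; identityˡ; identityʳ)

  ⨁ : List A → (A → C) → C
  ⨁ xs f = foldr _∙_ ε (map f xs)

  interchange : ∀ a b c d → (a ∙ b) ∙ (c ∙ d) ≡ (a ∙ c) ∙ (b ∙ d)
  interchange a b c d = begin
    (a ∙ b) ∙ (c ∙ d)  ≡⟨ assoc a b (c ∙ d) ⟩
    a ∙ (b ∙ (c ∙ d))  ≡⟨ cong (a ∙_) (sym (assoc b c d)) ⟩
    a ∙ ((b ∙ c) ∙ d)  ≡⟨ cong (λ x → a ∙ (x ∙ d)) (comm b c) ⟩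
    a ∙ ((c ∙ b) ∙ d)  ≡⟨ cong (a ∙_) (assoc c b d) ⟩
    a ∙ (c ∙ (b ∙ d))  ≡⟨ sym (assoc a c (b ∙ d)) ⟩
    (a ∙ c) ∙ (b ∙ d)  ∎
    where open ≡-Reasoning

  ⨁-cong : (xs : List A) {f g : A → C} → (∀ x → x ∈ xs → f x ≡ g x) → ⨁ xs f ≡ ⨁ xs g
  ⨁-cong []       f≡g = refl
  ⨁-cong (x ∷ xs) f≡g = cong₂ _∙_ (f≡g x (here refl)) (⨁-cong xs (λ y y∈ → f≡g y (there y∈)))

  ⨁-ε : (xs : List A) {f : A → C} → (∀ x → x ∈ xs → f x ≡ ε) → ⨁ xs f ≡ ε
  ⨁-ε []       f≡ε = refl
  ⨁-ε (x ∷ xs) f≡ε = trans (cong₂ _∙_ (f≡ε x (here refl)) (⨁-ε xs (λ y y∈ → f≡ε y (there y∈))))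
                           (identityˡ ε)

  ⨁-∙ : (xs : List A) (f g : A → C) → ⨁ xs (λ x → f x ∙ g x) ≡ ⨁ xs f ∙ ⨁ xs g
  ⨁-∙ []       f g = sym (identityˡ ε)
  ⨁-∙ (x ∷ xs) f g = trans (cong ((f x ∙ g x) ∙_) (⨁-∙ xs f g)) (interchange _ _ _ _)

  ⨁-++ : (xs ys : List A) (f : A → C) → ⨁ (xs ++ ys) f ≡ ⨁ xs f ∙ ⨁ ys f
  ⨁-++ []       ys f = sym (identityˡ _)
  ⨁-++ (x ∷ xs) ys f = trans (cong (f x ∙_) (⨁-++ xs ys f)) (sym (assoc _ _ _))

  ⨁-map : (xs : List A) (g : A → B) (f : B → C) → ⨁ (map g xs) f ≡ ⨁ xs (λ x → f (g x))
  ⨁-map []       g f = refl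
  ⨁-map (x ∷ xs) g f = cong (f (g x) ∙_) (⨁-map xs g f)

  ⨁-swap : (xs : List A) (ys : List B) (f : A → B → C) →
           ⨁ xs (λ x → ⨁ ys (f x)) ≡ ⨁ ys (λ y → ⨁ xs (λ x → f x y))
  ⨁-swap []       ys f = sym (⨁-ε ys (λ _ _ → refl))
  ⨁-swap (x ∷ xs) ys f = trans (cong (⨁ ys (f x) ∙_) (⨁-swap xs ys f))
                               (sym (⨁-∙ ys (f x) (λ y → ⨁ xs (λ x → f x y))))

  ⨁-cartesianProductWith : {D : Set} (g : A → B → D) (xs : List A) (ys : List B) (f : D → C) →
                           ⨁ (cartesianProductWith g xs ys) f ≡ ⨁ xs (λ x → ⨁ ys (λ y → f (g x y)))
  ⨁-cartesianProductWith g []       ys f = refl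
  ⨁-cartesianProductWith g (x ∷ xs) ys f = begin
    ⨁ (map (g x) ys ++ cartesianProductWith g xs ys) f
      ≡⟨ ⨁-++ (map (g x) ys) _ f ⟩
    ⨁ (map (g x) ys) f ∙ ⨁ (cartesianProductWith g xs ys) f
      ≡⟨ cong₂ _∙_ (⨁-map ys (g x) f) (⨁-cartesianProductWith g xs ys f) ⟩
    ⨁ ys (λ y → f (g x y)) ∙ ⨁ xs (λ x → ⨁ ys (λ y → f (g x y)))
      ∎
    where open ≡-Reasoning

  ⨁-filter : {P : A → Set} (P? : Decidable P) (xs : List A) (f : A → C) →
             ⨁ (filter P? xs) f ≡ ⨁ xs (λ x → if does (P? x) then f x else ε)
  ⨁-filter P? []       f = refl
  ⨁-filter P? (x ∷ xs) f with does (P? x)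
  ... | true  = cong (f x ∙_) (⨁-filter P? xs f)
  ... | false = trans (⨁-filter P? xs f) (sym (identityˡ _))

  ⨁-unique : (xs ys : List A) (f : A → C) → Unique xs → Unique ys →
             (∀ {z} → z ∈ xs → z ∈ ys) → (∀ {z} → z ∈ ys → z ∈ xs) → ⨁ xs f ≡ ⨁ ys f
  ⨁-unique xs ys f xs! ys! xs⊆ys ys⊆xs =
    foldr-commMonoid (setoid C) isCM (↭⇒↭ₛ (map⁺ f (unique-↭ xs! ys! xs⊆ys ys⊆xs)))

  ⨁-single : (_≟_ : DecidableEquality A) (xs : List A) (f : A → C) {x : A} →
             Unique xs → x ∈ xs → (∀ y → y ∈ xs → y ≢ x → f y ≡ ε) → ⨁ xs f ≡ f x
  ⨁-single _≟_ xs f {x} xs! x∈xs off-x = begin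
    ⨁ xs f                                         ≡⟨ ⨁-cong xs outside-x ⟩
    ⨁ xs (λ y → if does (y ≟ x) then f y else ε)  ≡⟨ sym (⨁-filter (_≟ x) xs f) ⟩
    ⨁ (filter (_≟ x) xs) f                        ≡⟨ ⨁-unique _ [ x ] f (Unique.filter⁺ (_≟ x) xs!)
                                                                    ([] AllPairs.∷ AllPairs.[]) only-x x-only ⟩
    f x ∙ ε                                        ≡⟨ identityʳ (f x) ⟩
    f x                                            ∎
    where
    open ≡-Reasoning
    outside-x : ∀ y → y ∈ xs → f y ≡ (if does (y ≟ x) then f y else ε)
    outside-x y y∈xs with y ≟ x
    ... | yes _   = refl
    ... | no  y≢x = off-x y y∈xs y≢x
    only-x : ∀ {z} → z ∈ filter (_≟ x) xs → z ∈ [ x ]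
    only-x z∈ with ∈-filter⁻ (_≟ x) {xs = xs} z∈
    ... | _ , refl = here refl
    x-only : ∀ {z} → z ∈ [ x ] → z ∈ filter (_≟ x) xs
    x-only (here refl) = ∈-filter⁺ (_≟ x) x∈xs refl

module _ {C D : Set} {_∙_ : Op₂ C} {ε : C} {_⊛_ : Op₂ D} {ε′ : D}
         (isCM₁ : IsCommutativeMonoid _≡_ _∙_ ε) (isCM₂ : IsCommutativeMonoid _≡_ _⊛_ ε′) where

  ⨁-hom : (h : C → D) → h ε ≡ ε′ → (∀ a b → h (a ∙ b) ≡ h a ⊛ h b) →
          (xs : List A) (f : A → C) → h (Big.⨁ _∙_ ε isCM₁ xs f) ≡ Big.⨁ _⊛_ ε′ isCM₂ xs (λ x → h (f x))
  ⨁-hom h h-ε h-∙ []       f = h-ε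
  ⨁-hom h h-ε h-∙ (x ∷ xs) f = trans (h-∙ (f x) _) (cong (h (f x) ⊛_) (⨁-hom h h-ε h-∙ xs f))

module Σℕ = Big _+_ 0 +-0-isCommutativeMonoid
module Πℕ = Big _*_ 1 *-1-isCommutativeMonoid

∑ : List A → (A → ℕ) → ℕ
∑ = Σℕ.⨁

∏ : List A → (A → ℕ) → ℕ
∏ = Πℕ.⨁

𝟙 : {Q : Set} → Dec Q → ℕ
𝟙 d = if does d then 1 else 0

if-yes : {Q X : Set} (d : Dec Q) {a b : X} → Q → (if does d then a else b) ≡ a
if-yes (yes _) q = refl
if-yes (no ¬q) q = ⊥-elim (¬q q)

if-no : {Q X : Set} (d : Dec Q) {a b : X} → ¬ Q → (if does d then a else b) ≡ b
if-no (yes q) ¬q = ⊥-elim (¬q q)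
if-no (no _)  ¬q = refl

length-∑ : (xs : List A) → length xs ≡ ∑ xs (λ _ → 1)
length-∑ []       = refl
length-∑ (x ∷ xs) = cong suc (length-∑ xs)

length-filter-∑ : {Q : A → Set} (Q? : Decidable Q) (xs : List A) →
                  length (filter Q? xs) ≡ ∑ xs (λ x → 𝟙 (Q? x))
length-filter-∑ Q? xs = trans (length-∑ (filter Q? xs)) (Σℕ.⨁-filter Q? xs (λ _ → 1))

^-∑ : (c : ℕ) (xs : List A) (e : A → ℕ) → c ^ ∑ xs e ≡ ∏ xs (λ x → c ^ e x)
^-∑ c = ⨁-hom +-0-isCommutativeMonoid *-1-isCommutativeMonoid (c ^_) refl (^-distribˡ-+-* c)

*-^ : ∀ a b e → (a * b) ^ e ≡ a ^ e * b ^ e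
*-^ a b zero    = refl
*-^ a b (suc e) = trans (cong ((a * b) *_) (*-^ a b e)) (Πℕ.interchange a b _ _)

∏-^ : (xs : List A) (g : A → ℕ) (e : ℕ) → ∏ xs g ^ e ≡ ∏ xs (λ x → g x ^ e)
∏-^ xs g e = ⨁-hom *-1-isCommutativeMonoid *-1-isCommutativeMonoid (_^ e) (^-zeroˡ e) (λ a b → *-^ a b e) xs g

^-𝟙 : {Q : Set} (c : ℕ) (d : Dec Q) → c ^ 𝟙 d ≡ (if does d then c else 1)
^-𝟙 c (yes _) = *-identityʳ c
^-𝟙 c (no _)  = refl

range-++ : ∀ a k l → range a (k + l) ≡ range a k ++ range (a + k) l
range-++ a zero    l = cong (λ b → range b l) (sym (+-identityʳ a))
range-++ a (suc k) l = cong (a ∷_) (trans (range-++ (suc a) k l) (cong (λ b → range (suc a) k ++ range b l) (sym (+-suc a k))))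

∈-range⁻ : ∀ {x} a k → x ∈ range a k → a ≤ x × x < a + k
∈-range⁻ a (suc k) (here refl) = ≤-refl , subst (a <_) (sym (+-suc a k)) (s≤s (m≤m+n a k))
∈-range⁻ {x} a (suc k) (there x∈)  with ∈-range⁻ (suc a) k x∈
... | a<x , x<a+k = <⇒≤ a<x , subst (x <_) (sym (+-suc a k)) x<a+k

∈-range⁺ : ∀ {x} a k → a ≤ x → x < a + k → x ∈ range a k
∈-range⁺ {x} a zero    a≤x x<a+k = ⊥-elim (<-irrefl refl (≤-<-trans a≤x (subst (x <_) (+-identityʳ a) x<a+k)))
∈-range⁺ {x} a (suc k) a≤x x<a+k with a ≟ x
... | yes refl = here refl
... | no  a≢x  = there (∈-range⁺ (suc a) k (≤∧≢⇒< a≤x a≢x) (subst (x <_) (+-suc a k) x<a+k))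

range-unique : ∀ a k → Unique (range a k)
range-unique a zero    = AllPairs.[]
range-unique a (suc k) =
  All.tabulate (λ x∈ a≡x → <-irrefl a≡x (proj₁ (∈-range⁻ (suc a) k x∈))) AllPairs.∷ range-unique (suc a) k

∈-range1⁻ : ∀ {t} n → t ∈ range 1 n → 1 ≤ t × t ≤ n
∈-range1⁻ n t∈ with ∈-range⁻ 1 n t∈
... | 1≤t , t<1+n = 1≤t , ≤-pred t<1+n

∈-range1⁺ : ∀ {t} n → 1 ≤ t → t ≤ n → t ∈ range 1 n
∈-range1⁺ n 1≤t t≤n = ∈-range⁺ 1 n 1≤t (s≤s t≤n)

module _ {C : Set} (_∙_ : Op₂ C) (ε : C) (isCM : IsCommutativeMonoid _≡_ _∙_ ε) where

  open Big _∙_ ε isCM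
  open IsCommutativeMonoid isCM using (identityʳ)

  ⨁-truncate : ∀ {m n} → m ≤ n → (g : ℕ → C) →
               ⨁ (range 1 n) (λ t → if does (t ≤? m) then g t else ε) ≡ ⨁ (range 1 m) g
  ⨁-truncate {m} {n} m≤n g with m≤n⇒∃[o]m+o≡n m≤n
  ... | d , refl = begin
    ⨁ (range 1 (m + d)) g≤m                             ≡⟨ cong (λ ts → ⨁ ts g≤m) (range-++ 1 m d) ⟩
    ⨁ (range 1 m ++ range (suc m) d) g≤m                ≡⟨ ⨁-++ (range 1 m) _ g≤m ⟩
    ⨁ (range 1 m) g≤m ∙ ⨁ (range (suc m) d) g≤m        ≡⟨ cong₂ _∙_ (⨁-cong (range 1 m) below) (⨁-ε _ above) ⟩
    ⨁ (range 1 m) g ∙ ε                                 ≡⟨ identityʳ _ ⟩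
    ⨁ (range 1 m) g                                     ∎
    where
    open ≡-Reasoning
    g≤m : ℕ → C
    g≤m t = if does (t ≤? m) then g t else ε
    below : ∀ t → t ∈ range 1 m → g≤m t ≡ g t
    below t t∈ = if-yes (t ≤? m) (proj₂ (∈-range1⁻ m t∈))
    above : ∀ t → t ∈ range (suc m) d → g≤m t ≡ ε
    above t t∈ = if-no (t ≤? m) (<⇒≱ (proj₁ (∈-range⁻ (suc m) d t∈)))

count-≤ : ∀ {m n} → m ≤ n → ∑ (range 1 n) (λ t → 𝟙 (t ≤? m)) ≡ m
count-≤ {m} {n} m≤n = begin
  ∑ (range 1 n) (λ t → 𝟙 (t ≤? m))  ≡⟨ ⨁-truncate _+_ 0 +-0-isCommutativeMonoid m≤n (λ _ → 1) ⟩
  ∑ (range 1 m) (λ _ → 1)           ≡⟨ sym (length-∑ (range 1 m)) ⟩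
  length (range 1 m)                ≡⟨ length-range 1 m ⟩
  m                                 ∎
  where
  open ≡-Reasoning
  length-range : ∀ a k → length (range a k) ≡ k
  length-range a zero    = refl
  length-range a (suc k) = cong suc (length-range (suc a) k)

factorial-∏ : ∀ {m n} → m ≤ n → ∏ (range 1 n) (λ t → t ^ 𝟙 (t ≤? m)) ≡ m !
factorial-∏ {m} {n} m≤n = begin
  ∏ (range 1 n) (λ t → t ^ 𝟙 (t ≤? m))                  ≡⟨ Πℕ.⨁-cong (range 1 n) (λ t _ → ^-𝟙 t (t ≤? m)) ⟩
  ∏ (range 1 n) (λ t → if does (t ≤? m) then t else 1)  ≡⟨ ⨁-truncate _*_ 1 *-1-isCommutativeMonoid m≤n (λ t → t) ⟩
  ∏ (range 1 m) (λ t → t)                                ≡⟨ ∏-range1 m ⟩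
  m !                                                    ∎
  where
  open ≡-Reasoning
  ∏-range1 : ∀ m → ∏ (range 1 m) (λ t → t) ≡ m !
  ∏-range1 zero    = refl
  ∏-range1 (suc m) = begin
    ∏ (range 1 (suc m)) (λ t → t)               ≡⟨ cong (λ k → ∏ (range 1 k) (λ t → t)) (+-comm 1 m) ⟩
    ∏ (range 1 (m + 1)) (λ t → t)               ≡⟨ cong (λ ts → ∏ ts (λ t → t)) (range-++ 1 m 1) ⟩
    ∏ (range 1 m ++ [ suc m ]) (λ t → t)        ≡⟨ Πℕ.⨁-++ (range 1 m) [ suc m ] (λ t → t) ⟩
    ∏ (range 1 m) (λ t → t) * (suc m * 1)       ≡⟨ cong₂ _*_ (∏-range1 m) (*-identityʳ (suc m)) ⟩
    m ! * suc m                                 ≡⟨ *-comm (m !) (suc m) ⟩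
    suc m !                                     ∎

mult-↭ : ∀ i {xs ys} → xs ↭ ys → mult i xs ≡ mult i ys
mult-↭ i xs↭ys = ↭-length (filter-↭ (_≟ i) xs↭ys)

mult-++ : ∀ i xs ys → mult i (xs ++ ys) ≡ mult i xs + mult i ys
mult-++ i xs ys = trans (cong length (filter-++ (_≟ i) xs ys)) (length-++ (filter (_≟ i) xs))

mult-∷ : ∀ i x xs → mult i (x ∷ xs) ≡ 𝟙 (x ≟ i) + mult i xs
mult-∷ i x xs with does (x ≟ i)
... | true  = refl
... | false = refl

mult-head : ∀ x xs → mult x (x ∷ xs) ≡ suc (mult x xs)
mult-head x xs = trans (mult-∷ x x xs) (cong (_+ mult x xs) (if-yes (x ≟ x) refl))

mult-replicate : ∀ c x → mult x (replicate c x) ≡ c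
mult-replicate zero    x = refl
mult-replicate (suc c) x = trans (mult-head x _) (cong suc (mult-replicate c x))

mult≥1⇒∈ : ∀ x ys → 1 ≤ mult x ys → x ∈ ys
mult≥1⇒∈ x (y ∷ ys) 1≤mult with y ≟ x
... | yes refl = here refl
... | no  y≢x  = there (mult≥1⇒∈ x ys (subst (1 ≤_) (cong length (filter-reject (_≟ x) y≢x)) 1≤mult))

sum-replicate : ∀ c x → sum (replicate c x) ≡ c * x
sum-replicate zero    x = refl
sum-replicate (suc c) x = cong (x +_) (sum-replicate c x)

product-mult : ∀ n ρ → All (λ x → x ∈ range 1 n) ρ → product ρ ≡ ∏ (range 1 n) (λ t → t ^ mult t ρ)
product-mult n []       _ = sym (Πℕ.⨁-ε (range 1 n) (λ _ _ → refl))
product-mult n (x ∷ ρ) (x∈ ∷ ρ⊆) = begin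
  x * product ρ
    ≡⟨ cong₂ _*_ (sym x-as-∏) (product-mult n ρ ρ⊆) ⟩
  ∏ R (λ t → t ^ 𝟙 (x ≟ t)) * ∏ R (λ t → t ^ mult t ρ)
    ≡⟨ sym (Πℕ.⨁-∙ R (λ t → t ^ 𝟙 (x ≟ t)) (λ t → t ^ mult t ρ)) ⟩
  ∏ R (λ t → t ^ 𝟙 (x ≟ t) * t ^ mult t ρ)
    ≡⟨ Πℕ.⨁-cong R (λ t _ → trans (sym (^-distribˡ-+-* t (𝟙 (x ≟ t)) (mult t ρ)))
                                  (cong (t ^_) (sym (mult-∷ t x ρ)))) ⟩
  ∏ R (λ t → t ^ mult t (x ∷ ρ))
    ∎
  where
  open ≡-Reasoning
  R = range 1 n
  x-as-∏ : ∏ R (λ t → t ^ 𝟙 (x ≟ t)) ≡ x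
  x-as-∏ = trans (Πℕ.⨁-single _≟_ R _ (range-unique 1 n) x∈
                   (λ t _ t≢x → cong (t ^_) (if-no (x ≟ t) (λ x≡t → t≢x (sym x≡t)))))
                 (trans (cong (x ^_) (if-yes (x ≟ x) refl)) (*-identityʳ x))

Decreasing : List ℕ → Set
Decreasing = Linked _≥_

decreasing-↭⇒≡ : {xs ys : List ℕ} → Decreasing xs → Decreasing ys → xs ↭ ys → xs ≡ ys
decreasing-↭⇒≡ xs↘ ys↘ xs↭ys = Pointwise-≡⇒≡ (↗↭↗⇒≋ ≥-totalOrder xs↘ ys↘ (↭⇒↭ₛ xs↭ys))

replicate-cancel : ∀ c (x : ℕ) {ys zs : List ℕ} → replicate c x ++ ys ↭ replicate c x ++ zs → ys ↭ zs
replicate-cancel zero    x p = p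
replicate-cancel (suc c) x p = replicate-cancel c x (drop-∷ p)

delete : ℕ → List ℕ → List ℕ
delete x []       = []
delete x (y ∷ ys) with y ≟ x
... | yes _ = ys
... | no  _ = y ∷ delete x ys

deleteN : ℕ → ℕ → List ℕ → List ℕ
deleteN zero    x ys = ys
deleteN (suc c) x ys = deleteN c x (delete x ys)

delete-↭ : ∀ x ys → x ∈ ys → ys ↭ x ∷ delete x ys
delete-↭ x (y ∷ ys) x∈ with y ≟ x | x∈
... | yes refl | _          = ↭-refl
... | no  y≢x  | here refl  = ⊥-elim (y≢x refl)
... | no  y≢x  | there x∈ys = ↭-trans (↭-prep y (delete-↭ x ys x∈ys)) (↭-swap y x ↭-refl)

deleteN-↭ : ∀ c x ys → c ≤ mult x ys → ys ↭ replicate c x ++ deleteN c x ys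
deleteN-↭ zero    x ys c≤mult = ↭-refl
deleteN-↭ (suc c) x ys c≤mult = ↭-trans ys↭x∷del (↭-prep x (deleteN-↭ c x (delete x ys) c≤mult-del))
  where
  ys↭x∷del = delete-↭ x ys (mult≥1⇒∈ x ys (≤-trans (s≤s z≤n) c≤mult))
  c≤mult-del : c ≤ mult x (delete x ys)
  c≤mult-del = ≤-pred (subst (suc c ≤_) (trans (mult-↭ x ys↭x∷del) (mult-head x _)) c≤mult)

move : (c x c′ x′ : ℕ) → List ℕ → List ℕ
move c x c′ x′ ρ = sort (replicate c′ x′ ++ deleteN c x ρ)

module _ {c x : ℕ} {ρ : List ℕ} (c≤mult : c ≤ mult x ρ) (c′ x′ : ℕ) where

  private
    D = deleteN c x ρ
    ρ↭ : ρ ↭ replicate c x ++ D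
    ρ↭ = deleteN-↭ c x ρ c≤mult
    move-↭ : move c x c′ x′ ρ ↭ replicate c′ x′ ++ D
    move-↭ = sort-↭ (replicate c′ x′ ++ D)

  move-↘ : Decreasing (move c x c′ x′ ρ)
  move-↘ = sort-↗ (replicate c′ x′ ++ D)

  move-mult : c′ ≤ mult x′ (move c x c′ x′ ρ)
  move-mult = subst (c′ ≤_) (sym mult-moved) (m≤m+n c′ (mult x′ D))
    where
    open ≡-Reasoning
    mult-moved : mult x′ (move c x c′ x′ ρ) ≡ c′ + mult x′ D
    mult-moved = begin
      mult x′ (move c x c′ x′ ρ)             ≡⟨ mult-↭ x′ move-↭ ⟩
      mult x′ (replicate c′ x′ ++ D)         ≡⟨ mult-++ x′ (replicate c′ x′) D ⟩
      mult x′ (replicate c′ x′) + mult x′ D  ≡⟨ cong (_+ mult x′ D) (mult-replicate c′ x′) ⟩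
      c′ + mult x′ D                         ∎

  move-All : {P : ℕ → Set} → P x′ → All P ρ → All P (move c x c′ x′ ρ)
  move-All Px′ Pρ = All-resp-↭ (↭-sym move-↭)
    (All.++⁺ (All.replicate⁺ c′ Px′) (All.++⁻ʳ (replicate c x) (All-resp-↭ ρ↭ Pρ)))

  move-sum : c * x ≡ c′ * x′ → sum (move c x c′ x′ ρ) ≡ sum ρ
  move-sum weight = begin
    sum (move c x c′ x′ ρ)          ≡⟨ sum-↭ move-↭ ⟩
    sum (replicate c′ x′ ++ D)      ≡⟨ sum-++ (replicate c′ x′) D ⟩
    sum (replicate c′ x′) + sum D   ≡⟨ cong (_+ sum D) (trans (sum-replicate c′ x′) (sym weight)) ⟩
    c * x + sum D                   ≡⟨ cong (_+ sum D) (sym (sum-replicate c x)) ⟩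
    sum (replicate c x) + sum D     ≡⟨ sym (sum-++ (replicate c x) D) ⟩
    sum (replicate c x ++ D)        ≡⟨ sum-↭ (↭-sym ρ↭) ⟩
    sum ρ                           ∎
    where open ≡-Reasoning

  move-back : Decreasing ρ → move c′ x′ c x (move c x c′ x′ ρ) ≡ ρ
  move-back ρ↘ = decreasing-↭⇒≡ (sort-↗ (replicate c x ++ deleteN c′ x′ ρ′)) ρ↘ (begin
    move c′ x′ c x ρ′                  ↭⟨ sort-↭ (replicate c x ++ deleteN c′ x′ ρ′) ⟩
    replicate c x ++ deleteN c′ x′ ρ′  ↭⟨ ++⁺ˡ (replicate c x) D′↭D ⟩
    replicate c x ++ D                 ↭⟨ ↭-sym ρ↭ ⟩
    ρ                                  ∎)
    where
    open PermutationReasoning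
    ρ′ = move c x c′ x′ ρ
    D′↭D : deleteN c′ x′ ρ′ ↭ D
    D′↭D = replicate-cancel c′ x′ (↭-trans (↭-sym (deleteN-↭ c′ x′ ρ′ move-mult)) move-↭)

parts-in-range : ∀ {n ρ} → IsPartition n ρ → All (λ x → x ∈ range 1 n) ρ
parts-in-range {n} {ρ} (1≤ρ , _ , Σρ≡n) =
  All.tabulate (λ {x} x∈ρ → ∈-range1⁺ n (All.lookup 1≤ρ x∈ρ) (subst (x ≤_) Σρ≡n (part≤sum ρ x∈ρ)))
  where
  part≤sum : ∀ ρ {x} → x ∈ ρ → x ≤ sum ρ
  part≤sum (y ∷ ρ) (here refl) = m≤m+n y (sum ρ)
  part≤sum (y ∷ ρ) (there x∈ρ) = ≤-trans (part≤sum ρ x∈ρ) (m≤n+m (sum ρ) y)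

mult≤n : ∀ {n ρ} i → IsPartition n ρ → mult i ρ ≤ n
mult≤n {n} {ρ} i (1≤ρ , _ , Σρ≡n) =
  ≤-trans (length-filter (_≟ i) ρ) (subst (length ρ ≤_) Σρ≡n (length≤sum ρ 1≤ρ))
  where
  length≤sum : ∀ ρ → All (1 ≤_) ρ → length ρ ≤ sum ρ
  length≤sum []      _          = z≤n
  length≤sum (x ∷ ρ) (1≤x ∷ 1≤ρ) = +-mono-≤ 1≤x (length≤sum ρ 1≤ρ)

NotDivAny : {m : ℕ} → (Fin m → ℕ) → ℕ → Set
NotDivAny {m} r j = (l : Fin m) → ¬ (r l ∣ j)

mult-excluded : ∀ {m n ρ} {r : Fin m → ℕ} t → IsCP r n ρ → ¬ NotDivAny r t → mult t ρ ≡ 0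
mult-excluded {ρ = ρ} t (_ , ρ-ok) t-bad =
  n≤0⇒n≡0 (≮⇒≥ (λ 1≤mult → t-bad (All.lookup ρ-ok (mult≥1⇒∈ t ρ 1≤mult))))

move-CP : ∀ {m n c x c′ x′ ρ} {r : Fin m → ℕ} → IsCP r n ρ → (c≤mult : c ≤ mult x ρ) →
          1 ≤ x′ → NotDivAny r x′ → c * x ≡ c′ * x′ → IsCP r n (move c x c′ x′ ρ)
move-CP {c′ = c′} {x′} ((1≤ρ , ρ↘ , Σρ≡n) , ρ-ok) c≤mult 1≤x′ x′-ok weight =
  ( move-All c≤mult c′ x′ 1≤x′ 1≤ρ
  , move-↘ c≤mult c′ x′
  , trans (move-sum c≤mult c′ x′ weight) Σρ≡n )
  , move-All c≤mult c′ x′ x′-ok ρ-ok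

module Counting {m : ℕ} (r : Fin m → ℕ) (n : ℕ) (L : List (List ℕ)) (L! : Unique L)
                (L⇔ : ∀ ρ → (ρ ∈ L) ⇔ IsCP r n ρ) where

  open Equivalence using (to; from)

  atLeast : ℕ → ℕ → ℕ
  atLeast i s = length (filter (λ ρ → s ≤? mult i ρ) L)

  private
    moved-∈ : ∀ i s i′ s′ {ρ} → 1 ≤ i′ → NotDivAny r i′ → s * i ≡ s′ * i′ →
              ρ ∈ filter (λ ρ → s ≤? mult i ρ) L → move s i s′ i′ ρ ∈ filter (λ ρ → s′ ≤? mult i′ ρ) L
    moved-∈ i s i′ s′ {ρ} 1≤i′ i′-ok weight ρ∈ with ∈-filter⁻ (λ ρ → s ≤? mult i ρ) {xs = L} ρ∈
    ... | ρ∈L , s≤mult =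
      ∈-filter⁺ (λ ρ → s′ ≤? mult i′ ρ)
        (from (L⇔ (move s i s′ i′ ρ)) (move-CP {c′ = s′} {x′ = i′} (to (L⇔ ρ) ρ∈L) s≤mult 1≤i′ i′-ok weight))
        (move-mult s≤mult s′ i′)

    moved-back : ∀ i s i′ s′ {ρ} → ρ ∈ filter (λ ρ → s ≤? mult i ρ) L → move s′ i′ s i (move s i s′ i′ ρ) ≡ ρ
    moved-back i s i′ s′ {ρ} ρ∈ with ∈-filter⁻ (λ ρ → s ≤? mult i ρ) {xs = L} ρ∈
    ... | ρ∈L , s≤mult = let ((_ , ρ↘ , _) , _) = to (L⇔ ρ) ρ∈L in move-back s≤mult s′ i′ ρ↘

  atLeast-swap : ∀ {i s i′ s′} → 1 ≤ i → NotDivAny r i → 1 ≤ i′ → NotDivAny r i′ →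
                 s * i ≡ s′ * i′ → atLeast i s ≡ atLeast i′ s′
  atLeast-swap {i} {s} {i′} {s′} 1≤i i-ok 1≤i′ i′-ok weight = begin
    length xs                         ≡⟨ sym (length-map (move s i s′ i′) xs) ⟩
    length (map (move s i s′ i′) xs)  ≡⟨ ↭-length (unique-↭ moved! (Unique.filter⁺ _ L!) forth back) ⟩
    length ys                         ∎
    where
    open ≡-Reasoning
    xs = filter (λ ρ → s ≤? mult i ρ) L
    ys = filter (λ ρ → s′ ≤? mult i′ ρ) L
    moved! : Unique (map (move s i s′ i′) xs)
    moved! = map-unique (setoid (List ℕ)) (move s i s′ i′)
      (λ ρ∈ ρ′∈ eq → trans (sym (moved-back i s i′ s′ ρ∈))
                           (trans (cong (move s′ i′ s i) eq) (moved-back i s i′ s′ ρ′∈)))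
      (Unique.filter⁺ _ L!)
    forth : ∀ {z} → z ∈ map (move s i s′ i′) xs → z ∈ ys
    forth z∈ with ∈-map⁻ (move s i s′ i′) z∈
    ... | ρ , ρ∈ , refl = moved-∈ i s i′ s′ 1≤i′ i′-ok weight ρ∈
    back : ∀ {z} → z ∈ ys → z ∈ map (move s i s′ i′) xs
    back z∈ = subst (_∈ map (move s i s′ i′) xs) (moved-back i′ s′ i s z∈)
                    (∈-map⁺ (move s i s′ i′) (moved-∈ i′ s′ i s 1≤i i-ok (sym weight) z∈))

prodFin-suc : ∀ m (f : Fin (suc m) → ℕ) → prodFin (suc m) f ≡ f zero * prodFin m (f ∘ suc)
prodFin-suc m f = cong (λ xs → f zero * product xs) (trans (map-tabulate suc f) (sym (map-tabulate (λ l → l) (f ∘ suc))))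

prodFin-cong : ∀ m {f g : Fin m → ℕ} → (∀ l → f l ≡ g l) → prodFin m f ≡ prodFin m g
prodFin-cong zero    f≡g = refl
prodFin-cong (suc m) {f} {g} f≡g =
  trans (prodFin-suc m f) (trans (cong₂ _*_ (f≡g zero) (prodFin-cong m (f≡g ∘ suc))) (sym (prodFin-suc m g)))

prodFin-pos : ∀ m (f : Fin m → ℕ) → (∀ l → 1 ≤ f l) → 1 ≤ prodFin m f
prodFin-pos zero    f 1≤f = ≤-refl
prodFin-pos (suc m) f 1≤f =
  subst (1 ≤_) (sym (prodFin-suc m f)) (*-mono-≤ (1≤f zero) (prodFin-pos m (f ∘ suc) (1≤f ∘ suc)))

powProd : {m : ℕ} → (Fin m → ℕ) → Vector ℕ m → ℕ
powProd {m} r k = prodFin m (λ l → r l ^ k l)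

powProd-pos : ∀ {m} (r : Fin m → ℕ) → (∀ l → 2 ≤ r l) → ∀ k → 1 ≤ powProd r k
powProd-pos {m} r 2≤r k = prodFin-pos m _ (λ l → 1≤^ (k l) (≤-trans (s≤s z≤n) (2≤r l)))
  where
  1≤^ : ∀ {a} e → 1 ≤ a → 1 ≤ a ^ e
  1≤^ zero    1≤a = ≤-refl
  1≤^ (suc e) 1≤a = *-mono-≤ 1≤a (1≤^ e 1≤a)

powProd-suc : ∀ {m} (r : Fin (suc m) → ℕ) k j → powProd r k * j ≡ r zero ^ k zero * (powProd (r ∘ suc) (k ∘ suc) * j)
powProd-suc {m} r k j =
  trans (cong (_* j) (prodFin-suc m (λ l → r l ^ k l))) (*-assoc (r zero ^ k zero) (powProd (r ∘ suc) (k ∘ suc)) j)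

record Split (q x : ℕ) : Set where
  field
    e u : ℕ
    x≡  : x ≡ q ^ e * u
    q∤u : ¬ (q ∣ u)
    e≤x : e ≤ x
    u≤x : u ≤ x
    1≤u : 1 ≤ u

split-acc : ∀ {q} → 2 ≤ q → ∀ x → 1 ≤ x → Acc _<_ x → Split q x
split-acc {q} 2≤q x 1≤x (acc smaller) with q ∣? x
... | no q∤x = record
  { e = 0 ; u = x ; x≡ = sym (+-identityʳ x) ; q∤u = q∤x ; e≤x = z≤n ; u≤x = ≤-refl ; 1≤u = 1≤x }
... | yes (divides y x≡y*q) = record
  { e = suc S.e ; u = S.u ; x≡ = x≡ ; q∤u = S.q∤u
  ; e≤x = ≤-trans (s≤s S.e≤x) y<x ; u≤x = ≤-trans S.u≤x (<⇒≤ y<x) ; 1≤u = S.1≤u }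
  where
  1≤y : 1 ≤ y
  1≤y = n≢0⇒n>0 (λ { refl → <-irrefl refl (subst (1 ≤_) x≡y*q 1≤x) })
  y<x : y < x
  y<x = subst (y <_) (sym x≡y*q) (m<m*n y q {{>-nonZero 1≤y}} 2≤q)
  module S = Split (split-acc 2≤q y 1≤y (smaller y<x))
  x≡ : x ≡ q ^ suc S.e * S.u
  x≡ = begin
    x                    ≡⟨ x≡y*q ⟩
    y * q                ≡⟨ *-comm y q ⟩
    q * y                ≡⟨ cong (q *_) S.x≡ ⟩
    q * (q ^ S.e * S.u)  ≡⟨ sym (*-assoc q (q ^ S.e) S.u) ⟩
    q ^ suc S.e * S.u    ∎
    where open ≡-Reasoning

split : ∀ {q} → 2 ≤ q → ∀ x → 1 ≤ x → Split q x
split 2≤q x 1≤x = split-acc 2≤q x 1≤x (<-wellFounded x)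

record Factorisation {m : ℕ} (r : Fin m → ℕ) (x : ℕ) : Set where
  field
    j    : ℕ
    k    : Vector ℕ m
    x≡   : x ≡ powProd r k * j
    j-ok : NotDivAny r j
    k≤x  : ∀ l → k l ≤ x
    j≤x  : j ≤ x
    1≤j  : 1 ≤ j

factorise : ∀ {m} (r : Fin m → ℕ) → (∀ l → 2 ≤ r l) → ∀ x → 1 ≤ x → Factorisation r x
factorise {zero}  r 2≤r x 1≤x = record
  { j = x ; k = λ () ; x≡ = sym (+-identityʳ x) ; j-ok = λ () ; k≤x = λ () ; j≤x = ≤-refl ; 1≤j = 1≤x }
factorise {suc m} r 2≤r x 1≤x = record
  { j = F.j ; k = S.e ∷ᵥ F.k ; x≡ = x≡ ; j-ok = j-ok ; k≤x = k≤x ; j≤x = ≤-trans F.j≤x S.u≤x ; 1≤j = F.1≤j }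
  where
  module S = Split (split (2≤r zero) x 1≤x)
  module F = Factorisation (factorise (r ∘ suc) (2≤r ∘ suc) S.u S.1≤u)
  x≡ : x ≡ powProd r (S.e ∷ᵥ F.k) * F.j
  x≡ = trans S.x≡ (trans (cong (r zero ^ S.e *_) F.x≡) (sym (powProd-suc r (S.e ∷ᵥ F.k) F.j)))
  j-ok : NotDivAny r F.j
  j-ok zero    r₀∣j = S.q∤u (∣-trans r₀∣j (subst (F.j ∣_) (sym F.x≡) (n∣m*n (powProd (r ∘ suc) F.k))))
  j-ok (suc l) = F.j-ok l
  k≤x : ∀ l → (S.e ∷ᵥ F.k) l ≤ x
  k≤x zero    = S.e≤x
  k≤x (suc l) = ≤-trans (F.k≤x l) S.u≤x

coprime-∣-^* : ∀ {d a} e y → Coprime d a → d ∣ a ^ e * y → d ∣ y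
coprime-∣-^* {d} zero    y d⊥a d∣ = subst (d ∣_) (+-identityʳ y) d∣
coprime-∣-^* {d} {a} (suc e) y d⊥a d∣ =
  coprime-∣-^* e y d⊥a (coprime-divisor d⊥a (subst (d ∣_) (*-assoc a (a ^ e) y) d∣))

coprime-∣-powProd : ∀ {m d} (r : Fin m → ℕ) k j → (∀ l → Coprime d (r l)) → d ∣ powProd r k * j → d ∣ j
coprime-∣-powProd {zero}  {d} r k j d⊥r d∣ = subst (d ∣_) (+-identityʳ j) d∣
coprime-∣-powProd {suc m} {d} r k j d⊥r d∣ =
  coprime-∣-powProd (r ∘ suc) (k ∘ suc) j (d⊥r ∘ suc)
    (coprime-∣-^* (k zero) _ (d⊥r zero) (subst (d ∣_) (powProd-suc r k j) d∣))

split-unique : ∀ {q} e e′ {u u′} → 1 ≤ q → ¬ (q ∣ u) → ¬ (q ∣ u′) →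
               q ^ e * u ≡ q ^ e′ * u′ → e ≡ e′ × u ≡ u′
split-unique zero zero {u} {u′} 1≤q q∤u q∤u′ eq = refl , trans (sym (+-identityʳ u)) (trans eq (+-identityʳ u′))
split-unique {q} (suc e) zero {u} {u′} 1≤q q∤u q∤u′ eq =
  ⊥-elim (q∤u′ (subst (q ∣_) (trans (sym (*-assoc q (q ^ e) u)) (trans eq (+-identityʳ u′))) (m∣m*n _)))
split-unique {q} zero (suc e′) {u} {u′} 1≤q q∤u q∤u′ eq =
  ⊥-elim (q∤u (subst (q ∣_) (trans (sym (*-assoc q (q ^ e′) u′)) (trans (sym eq) (+-identityʳ u))) (m∣m*n _)))
split-unique {q} (suc e) (suc e′) {u} {u′} 1≤q q∤u q∤u′ eq
  with split-unique e e′ 1≤q q∤u q∤u′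
         (*-cancelˡ-≡ _ _ q {{>-nonZero 1≤q}} (trans (sym (*-assoc q (q ^ e) u)) (trans eq (*-assoc q (q ^ e′) u′))))
... | refl , u≡u′ = refl , u≡u′

factorisation-unique : ∀ {m} (r : Fin m → ℕ) → (∀ l → 2 ≤ r l) →
                       (∀ l l′ → l ≢ l′ → Coprime (r l) (r l′)) →
                       ∀ {j j′} k k′ → NotDivAny r j → NotDivAny r j′ →
                       powProd r k * j ≡ powProd r k′ * j′ → j ≡ j′ × (∀ l → k l ≡ k′ l)
factorisation-unique {zero} r 2≤r r-coprime {j} {j′} k k′ j-ok j′-ok eq =
  trans (sym (+-identityʳ j)) (trans eq (+-identityʳ j′)) , λ ()
factorisation-unique {suc m} r 2≤r r-coprime {j} {j′} k k′ j-ok j′-ok eq =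
  proj₁ tail-unique , λ { zero → proj₁ head-unique ; (suc l) → proj₂ tail-unique l }
  where
  -- r₀ is coprime to the other bases, so it cannot divide the rest of the factorisation
  r₀∤ : ∀ k j → NotDivAny r j → ¬ (r zero ∣ powProd (r ∘ suc) (k ∘ suc) * j)
  r₀∤ k j j-ok r₀∣ = j-ok zero (coprime-∣-powProd (r ∘ suc) (k ∘ suc) j (λ l → r-coprime zero (suc l) (λ ())) r₀∣)
  head-unique : k zero ≡ k′ zero × powProd (r ∘ suc) (k ∘ suc) * j ≡ powProd (r ∘ suc) (k′ ∘ suc) * j′
  head-unique = split-unique (k zero) (k′ zero) (≤-trans (s≤s z≤n) (2≤r zero)) (r₀∤ k j j-ok) (r₀∤ k′ j′ j′-ok)
                  (trans (sym (powProd-suc r k j)) (trans eq (powProd-suc r k′ j′)))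
  tail-unique : j ≡ j′ × (∀ l → k (suc l) ≡ k′ (suc l))
  tail-unique = factorisation-unique (r ∘ suc) (2≤r ∘ suc)
                  (λ l l′ l≢l′ → r-coprime (suc l) (suc l′) (l≢l′ ∘ Fin.suc-injective))
                  (k ∘ suc) (k′ ∘ suc) (j-ok ∘ suc) (j′-ok ∘ suc) (proj₂ head-unique)

tuples : (m B : ℕ) → List (Vector ℕ m)
tuples zero    B = [ (λ ()) ]
tuples (suc m) B = cartesianProductWith _∷ᵥ_ (range 0 (suc B)) (tuples m B)

sumTuples-∑ : ∀ m B (f : Vector ℕ m → ℕ) → sumTuples m B f ≡ ∑ (tuples m B) f
sumTuples-∑ zero    B f = sym (+-identityʳ _)
sumTuples-∑ (suc m) B f =
  trans (Σℕ.⨁-cong (range 0 (suc B)) (λ a _ → sumTuples-∑ m B (f ∘ (a ∷ᵥ_))))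
        (sym (Σℕ.⨁-cartesianProductWith _∷ᵥ_ (range 0 (suc B)) (tuples m B) f))

tuples-unique : ∀ m B → UniqueSetoid.Unique (Fin m →-setoid ℕ) (tuples m B)
tuples-unique zero    B = [] AllPairs.∷ AllPairs.[]
tuples-unique (suc m) B =
  UniqueSetoid.cartesianProductWith⁺ (setoid ℕ) (Fin m →-setoid ℕ) (Fin (suc m) →-setoid ℕ) _∷ᵥ_
    (λ a∷v≗b∷w → a∷v≗b∷w zero , a∷v≗b∷w ∘ suc) (range-unique 0 (suc B)) (tuples-unique m B)

tuples-complete : ∀ m B (k : Vector ℕ m) → (∀ l → k l ≤ B) →
                  Σ[ k′ ∈ Vector ℕ m ] (k′ ∈ tuples m B × (∀ l → k′ l ≡ k l))
tuples-complete zero    B k k≤B = (λ ()) , here refl , λ ()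
tuples-complete (suc m) B k k≤B with tuples-complete m B (k ∘ suc) (k≤B ∘ suc)
... | k′ , k′∈ , k′≗k = (k zero ∷ᵥ k′)
                      , ∈-cartesianProductWith⁺ _∷ᵥ_ (∈-range⁺ 0 (suc B) z≤n (s≤s (k≤B zero))) k′∈
                      , λ { zero → refl ; (suc l) → k′≗k l }

admissible : {m : ℕ} → (Fin m → ℕ) → ℕ → List ℕ
admissible r n = filter (notDivAny? r) (range 1 n)

∈-admissible⁻ : ∀ {m} (r : Fin m → ℕ) n {j} → j ∈ admissible r n → (1 ≤ j × j ≤ n) × NotDivAny r j
∈-admissible⁻ r n j∈ with ∈-filter⁻ (notDivAny? r) {xs = range 1 n} j∈
... | j∈R , j-ok = ∈-range1⁻ n j∈R , j-ok

module FactorValues {m : ℕ} (r : Fin m → ℕ) (2≤r : ∀ l → 2 ≤ r l)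
                    (r-coprime : ∀ l l′ → l ≢ l′ → Coprime (r l) (r l′)) (n : ℕ) where

  J : List ℕ
  J = admissible r n

  K : List (Vector ℕ m)
  K = tuples m n

  value : ℕ × Vector ℕ m → ℕ
  value (j , k) = powProd r k * j

  values : List ℕ
  values = map value (cartesianProduct J K)

  values-unique : Unique values
  values-unique = map-unique (setoid ℕ ×ₛ (Fin m →-setoid ℕ)) value injective
    (UniqueSetoid.cartesianProduct⁺ (setoid ℕ) (Fin m →-setoid ℕ) (Unique.filter⁺ _ (range-unique 1 n)) (tuples-unique m n))
    where
    injective : ∀ {p q} → p ∈ cartesianProduct J K → q ∈ cartesianProduct J K → value p ≡ value q →
                proj₁ p ≡ proj₁ q × (∀ l → proj₂ p l ≡ proj₂ q l)
    injective {j , k} {j′ , k′} p∈ q∈ eq = factorisation-unique r 2≤r r-coprime k k′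
      (proj₂ (∈-admissible⁻ r n (proj₁ (∈-cartesianProduct⁻ J K p∈))))
      (proj₂ (∈-admissible⁻ r n (proj₁ (∈-cartesianProduct⁻ J K q∈)))) eq

  values≤n⇒∈range : ∀ {s} → s ∈ filter (_≤? n) values → s ∈ range 1 n
  values≤n⇒∈range s∈ with ∈-filter⁻ (_≤? n) {xs = values} s∈
  ... | s∈values , s≤n with ∈-map⁻ value s∈values
  ... | (j , k) , p∈ , refl = ∈-range1⁺ n
    (*-mono-≤ (powProd-pos r 2≤r k) (proj₁ (proj₁ (∈-admissible⁻ r n (proj₁ (∈-cartesianProduct⁻ J K p∈)))))) s≤n

  range⇒values≤n : ∀ {s} → s ∈ range 1 n → s ∈ filter (_≤? n) values
  range⇒values≤n {s} s∈ with ∈-range1⁻ n s∈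
  ... | 1≤s , s≤n with factorise r 2≤r s 1≤s
  ... | record { j = j ; k = k ; x≡ = s≡ ; j-ok = j-ok ; k≤x = k≤s ; j≤x = j≤s ; 1≤j = 1≤j }
    with tuples-complete m n k (λ l → ≤-trans (k≤s l) s≤n)
  ... | k′ , k′∈ , k′≗k = ∈-filter⁺ (_≤? n) (subst (_∈ values) (sym s≡′) (∈-map⁺ value jk′∈)) s≤n
    where
    jk′∈ : (j , k′) ∈ cartesianProduct J K
    jk′∈ = ∈-cartesianProduct⁺ (∈-filter⁺ (notDivAny? r) (∈-range1⁺ n 1≤j (≤-trans j≤s s≤n)) j-ok) k′∈
    s≡′ : s ≡ value (j , k′)
    s≡′ = trans s≡ (cong (_* j) (prodFin-cong m (λ l → cong (r l ^_) (sym (k′≗k l)))))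

  module _ {C : Set} (_∙_ : Op₂ C) (ε : C) (isCM : IsCommutativeMonoid _≡_ _∙_ ε) where

    open Big _∙_ ε isCM

    reindex : (h : ℕ → C) → (∀ s → n < s → h s ≡ ε) →
              ⨁ J (λ j → ⨁ K (λ k → h (powProd r k * j))) ≡ ⨁ (range 1 n) h
    reindex h h-vanishes = begin
      ⨁ J (λ j → ⨁ K (λ k → h (powProd r k * j)))          ≡⟨ sym (⨁-cartesianProductWith _,_ J K (h ∘ value)) ⟩
      ⨁ (cartesianProduct J K) (h ∘ value)                ≡⟨ sym (⨁-map (cartesianProduct J K) value h) ⟩
      ⨁ values h                                          ≡⟨ ⨁-cong values (λ s _ → cut s) ⟩
      ⨁ values (λ s → if does (s ≤? n) then h s else ε)  ≡⟨ sym (⨁-filter (_≤? n) values h) ⟩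
      ⨁ (filter (_≤? n) values) h                        ≡⟨ ⨁-unique _ _ h (Unique.filter⁺ _ values-unique) (range-unique 1 n)
                                                                   values≤n⇒∈range range⇒values≤n ⟩
      ⨁ (range 1 n) h                                    ∎
      where
      open ≡-Reasoning
      cut : ∀ s → h s ≡ (if does (s ≤? n) then h s else ε)
      cut s with s ≤? n
      ... | yes s≤n = sym (if-yes (s ≤? n) s≤n)
      ... | no  s≰n = trans (h-vanishes s (≰⇒> s≰n)) (sym (if-no (s ≤? n) s≰n))

    ⨁-admissible : (f : ℕ → C) → (∀ t → ¬ NotDivAny r t → f t ≡ ε) → ⨁ J f ≡ ⨁ (range 1 n) f
    ⨁-admissible f f-excluded = trans (⨁-filter (notDivAny? r) (range 1 n) f) (⨁-cong (range 1 n) (λ t _ → keep t))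
      where
      keep : ∀ t → (if does (notDivAny? r t) then f t else ε) ≡ f t
      keep t with notDivAny? r t
      ... | yes t-ok  = if-yes (notDivAny? r t) t-ok
      ... | no  t-bad = trans (if-no (notDivAny? r t) t-bad) (sym (f-excluded t t-bad))

module ProductFormulas {m : ℕ} (r : Fin m → ℕ) (2≤r : ∀ l → 2 ≤ r l)
                       (r-coprime : ∀ l l′ → l ≢ l′ → Coprime (r l) (r l′))
                       (n : ℕ) (L : List (List ℕ)) (L! : Unique L) (L⇔ : ∀ ρ → (ρ ∈ L) ⇔ IsCP r n ρ) where

  open FactorValues r 2≤r r-coprime n public using (J; K; reindex)
  open FactorValues r 2≤r r-coprime n using (⨁-admissible)
  open Counting r n L L! L⇔ using (atLeast; atLeast-swap)

  R : List ℕ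
  R = range 1 n

  ∈L⇒CP : ∀ {ρ} → ρ ∈ L → IsCP r n ρ
  ∈L⇒CP {ρ} = Equivalence.to (L⇔ ρ)

  w : ℕ → Vector ℕ m → ℕ
  w j k = W n L (powProd r k * j)

  M : ℕ → ℕ
  M t = ∑ L (mult t)

  atLeast-∑ : ∀ i s → atLeast i s ≡ ∑ L (λ ρ → 𝟙 (s ≤? mult i ρ))
  atLeast-∑ i s = length-filter-∑ (λ ρ → s ≤? mult i ρ) L

  W-∑ : ∀ s → W n L s ≡ ∑ L (λ ρ → ∑ R (λ i → 𝟙 (s ≤? mult i ρ)))
  W-∑ s = Σℕ.⨁-cong L (λ ρ _ → length-filter-∑ (λ i → s ≤? mult i ρ) R)

  W-atLeast : ∀ s → W n L s ≡ ∑ R (λ i → atLeast i s)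
  W-atLeast s = trans (W-∑ s) (trans (Σℕ.⨁-swap L R (λ ρ i → 𝟙 (s ≤? mult i ρ)))
                                     (Σℕ.⨁-cong R (λ i _ → sym (atLeast-∑ i s))))

  atLeast-beyond-n : ∀ i s → n < s → atLeast i s ≡ 0
  atLeast-beyond-n i s n<s = trans (atLeast-∑ i s) (Σℕ.⨁-ε L (λ ρ ρ∈ →
    if-no (s ≤? mult i ρ) (λ s≤mult → <⇒≱ n<s (≤-trans s≤mult (mult≤n i (proj₁ (∈L⇒CP ρ∈)))))))

  W-beyond-n : ∀ s → n < s → W n L s ≡ 0
  W-beyond-n s n<s = trans (W-atLeast s) (Σℕ.⨁-ε R (λ i _ → atLeast-beyond-n i s n<s))

  M-excluded : ∀ t → ¬ NotDivAny r t → M t ≡ 0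
  M-excluded t t-bad = Σℕ.⨁-ε L (λ ρ ρ∈ → mult-excluded t (∈L⇒CP ρ∈) t-bad)

  W-admissible : ∀ s → 1 ≤ s → W n L s ≡ ∑ J (λ i → atLeast i s)
  W-admissible s 1≤s = trans (W-atLeast s) (sym (⨁-admissible _+_ 0 +-0-isCommutativeMonoid (λ i → atLeast i s)
    (λ i i-bad → trans (atLeast-∑ i s) (Σℕ.⨁-ε L (λ ρ ρ∈ →
      if-no (s ≤? mult i ρ) (λ s≤mult → <⇒≱ 1≤s (subst (s ≤_) (mult-excluded i (∈L⇒CP ρ∈) i-bad) s≤mult)))))))

  b-as-∏ : bSeq n L ≡ ∏ R (λ s → s ^ W n L s)
  b-as-∏ = begin
    ∏ L (λ ρ → ∏ R (λ i → mult i ρ !))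
      ≡⟨ Πℕ.⨁-cong L (λ ρ ρ∈ → Πℕ.⨁-cong R (λ i _ → sym (factorial-∏ (mult≤n i (proj₁ (∈L⇒CP ρ∈)))))) ⟩
    ∏ L (λ ρ → ∏ R (λ i → ∏ R (λ s → s ^ 𝟙 (s ≤? mult i ρ))))
      ≡⟨ Πℕ.⨁-cong L (λ ρ _ → Πℕ.⨁-swap R R (λ i s → s ^ 𝟙 (s ≤? mult i ρ))) ⟩
    ∏ L (λ ρ → ∏ R (λ s → ∏ R (λ i → s ^ 𝟙 (s ≤? mult i ρ))))
      ≡⟨ Πℕ.⨁-swap L R (λ ρ s → ∏ R (λ i → s ^ 𝟙 (s ≤? mult i ρ))) ⟩
    ∏ R (λ s → ∏ L (λ ρ → ∏ R (λ i → s ^ 𝟙 (s ≤? mult i ρ))))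
      ≡⟨ Πℕ.⨁-cong R (λ s _ → sym (trans (^-∑ s L _) (Πℕ.⨁-cong L (λ ρ _ → ^-∑ s R _)))) ⟩
    ∏ R (λ s → s ^ ∑ L (λ ρ → ∑ R (λ i → 𝟙 (s ≤? mult i ρ))))
      ≡⟨ Πℕ.⨁-cong R (λ s _ → cong (s ^_) (sym (W-∑ s))) ⟩
    ∏ R (λ s → s ^ W n L s)
      ∎
    where open ≡-Reasoning

  a-as-∏ : aSeq L ≡ ∏ J (λ j → j ^ M j)
  a-as-∏ = begin
    ∏ L product                              ≡⟨ Πℕ.⨁-cong L (λ ρ ρ∈ → product-mult n ρ (parts-in-range (proj₁ (∈L⇒CP ρ∈)))) ⟩
    ∏ L (λ ρ → ∏ R (λ t → t ^ mult t ρ))     ≡⟨ Πℕ.⨁-swap L R (λ ρ t → t ^ mult t ρ) ⟩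
    ∏ R (λ t → ∏ L (λ ρ → t ^ mult t ρ))     ≡⟨ Πℕ.⨁-cong R (λ t _ → sym (^-∑ t L (mult t))) ⟩
    ∏ R (λ t → t ^ M t)                      ≡⟨ sym (⨁-admissible _*_ 1 *-1-isCommutativeMonoid (λ t → t ^ M t)
                                                                 (λ t t-bad → cong (t ^_) (M-excluded t t-bad))) ⟩
    ∏ J (λ j → j ^ M j)                      ∎
    where open ≡-Reasoning

  M-as-∑ : ∀ {j} → j ∈ J → M j ≡ ∑ K (w j)
  M-as-∑ {j} j∈J = begin
    ∑ L (mult j)
      ≡⟨ Σℕ.⨁-cong L (λ ρ ρ∈ → sym (count-≤ (mult≤n j (proj₁ (∈L⇒CP ρ∈))))) ⟩
    ∑ L (λ ρ → ∑ R (λ t → 𝟙 (t ≤? mult j ρ)))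
      ≡⟨ Σℕ.⨁-swap L R (λ ρ t → 𝟙 (t ≤? mult j ρ)) ⟩
    ∑ R (λ t → ∑ L (λ ρ → 𝟙 (t ≤? mult j ρ)))
      ≡⟨ Σℕ.⨁-cong R (λ t _ → sym (atLeast-∑ j t)) ⟩
    ∑ R (atLeast j)
      ≡⟨ sym (reindex _+_ 0 +-0-isCommutativeMonoid (atLeast j) (atLeast-beyond-n j)) ⟩
    ∑ J (λ i → ∑ K (λ k → atLeast j (powProd r k * i)))
      ≡⟨ Σℕ.⨁-cong J (λ i i∈J → Σℕ.⨁-cong K (λ k _ → trade i i∈J k)) ⟩
    ∑ J (λ i → ∑ K (λ k → atLeast i (powProd r k * j)))
      ≡⟨ Σℕ.⨁-swap J K (λ i k → atLeast i (powProd r k * j)) ⟩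
    ∑ K (λ k → ∑ J (λ i → atLeast i (powProd r k * j)))
      ≡⟨ Σℕ.⨁-cong K (λ k _ → sym (W-admissible (powProd r k * j) (*-mono-≤ (powProd-pos r 2≤r k) 1≤j))) ⟩
    ∑ K (w j)
      ∎
    where
    open ≡-Reasoning
    1≤j = proj₁ (proj₁ (∈-admissible⁻ r n j∈J))
    -- j occurring rᵏ·i times has the same weight as i occurring rᵏ·j times
    trade : ∀ i → i ∈ J → ∀ k → atLeast j (powProd r k * i) ≡ atLeast i (powProd r k * j)
    trade i i∈J k = atLeast-swap 1≤j (proj₂ (∈-admissible⁻ r n j∈J)) (proj₁ (proj₁ (∈-admissible⁻ r n i∈J)))
      (proj₂ (∈-admissible⁻ r n i∈J))
      (trans (*-assoc (powProd r k) i j) (trans (cong (powProd r k *_) (*-comm i j)) (sym (*-assoc (powProd r k) j i))))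

  rᵏ-part : ∏ J (λ j → ∏ K (λ k → powProd r k ^ w j k)) ≡ prodFin m (λ l → r l ^ cSeq r n L l)
  rᵏ-part = begin
    ∏ J (λ j → ∏ K (λ k → powProd r k ^ w j k))
      ≡⟨ Πℕ.⨁-cong J (λ j _ → Πℕ.⨁-cong K (λ k _ → trans (∏-^ (allFin m) (λ l → r l ^ k l) (w j k))
                                                      (Πℕ.⨁-cong (allFin m) (λ l _ → ^-*-assoc (r l) (k l) (w j k))))) ⟩
    ∏ J (λ j → ∏ K (λ k → ∏ (allFin m) (λ l → r l ^ (k l * w j k))))
      ≡⟨ Πℕ.⨁-cong J (λ j _ → Πℕ.⨁-swap K (allFin m) (λ k l → r l ^ (k l * w j k))) ⟩
    ∏ J (λ j → ∏ (allFin m) (λ l → ∏ K (λ k → r l ^ (k l * w j k))))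
      ≡⟨ Πℕ.⨁-swap J (allFin m) (λ j l → ∏ K (λ k → r l ^ (k l * w j k))) ⟩
    ∏ (allFin m) (λ l → ∏ J (λ j → ∏ K (λ k → r l ^ (k l * w j k))))
      ≡⟨ Πℕ.⨁-cong (allFin m) (λ l _ → sym (trans (^-∑ (r l) J _) (Πℕ.⨁-cong J (λ j _ → ^-∑ (r l) K _)))) ⟩
    ∏ (allFin m) (λ l → r l ^ ∑ J (λ j → ∑ K (λ k → k l * w j k)))
      ≡⟨ Πℕ.⨁-cong (allFin m) (λ l _ → cong (r l ^_) (sym (c-as-∑ l))) ⟩
    prodFin m (λ l → r l ^ cSeq r n L l)
      ∎
    where
    open ≡-Reasoning
    c-as-∑ : ∀ l → cSeq r n L l ≡ ∑ J (λ j → ∑ K (λ k → k l * w j k))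
    c-as-∑ l = Σℕ.⨁-cong J (λ j _ → sumTuples-∑ m n (λ k → k l * w j k))

  j-part : ∏ J (λ j → ∏ K (λ k → j ^ w j k)) ≡ aSeq L
  j-part = trans (Πℕ.⨁-cong J (λ j j∈J → trans (sym (^-∑ j K (w j))) (cong (j ^_) (sym (M-as-∑ j∈J)))))
                 (sym a-as-∏)

  split-factors : ∏ J (λ j → ∏ K (λ k → (powProd r k * j) ^ w j k))
                ≡ ∏ J (λ j → ∏ K (λ k → powProd r k ^ w j k)) * ∏ J (λ j → ∏ K (λ k → j ^ w j k))
  split-factors =
    trans (Πℕ.⨁-cong J (λ j _ → trans (Πℕ.⨁-cong K (λ k _ → *-^ (powProd r k) j (w j k)))
                                        (Πℕ.⨁-∙ K (λ k → powProd r k ^ w j k) (λ k → j ^ w j k))))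
          (Πℕ.⨁-∙ J (λ j → ∏ K (λ k → powProd r k ^ w j k)) (λ j → ∏ K (λ k → j ^ w j k)))

theorem2p3 : (m : ℕ) → 1 ≤ m → (r : Fin m → ℕ) → (∀ l → 2 ≤ r l) →
    (∀ l l′ → l ≢ l′ → Coprime (r l) (r l′)) →
    (n : ℕ) → (L : List (List ℕ)) → Unique L → (∀ ρ → (ρ ∈ L) ⇔ IsCP r n ρ) →
    bSeq n L ≡ prodFin m (λ i → r i ^ cSeq r n L i) * aSeq L
theorem2p3 m _ r 2≤r r-coprime n L L! L⇔ = begin
  bSeq n L
    ≡⟨ b-as-∏ ⟩
  ∏ R (λ s → s ^ W n L s)
    ≡⟨ sym (reindex _*_ 1 *-1-isCommutativeMonoid (λ s → s ^ W n L s) (λ s n<s → cong (s ^_) (W-beyond-n s n<s))) ⟩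
  ∏ J (λ j → ∏ K (λ k → (powProd r k * j) ^ w j k))
    ≡⟨ split-factors ⟩
  ∏ J (λ j → ∏ K (λ k → powProd r k ^ w j k)) * ∏ J (λ j → ∏ K (λ k → j ^ w j k))
    ≡⟨ cong₂ _*_ rᵏ-part j-part ⟩
  prodFin m (λ i → r i ^ cSeq r n L i) * aSeq L
    ∎
  where
  open ≡-Reasoning
  open ProductFormulas r 2≤r r-coprime n L L! L⇔
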